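{- Let $F$ be a field of characteristic zero, $f$ an anti-involution of $F^\times$, and $\Phi_f(C_n)=(C_n,F^\times,\varphi,f)$ a skew gain graph whose underlying graph is the cycle $C=C_n$, $n\ge3$. Then $\det(A(\Phi_f(C_n)))=\varphi(C)+f(\varphi(C))$ if $n$ is odd, and $$\det(A(\Phi_f(C_n)))=(-1)^{n/2}\sum_{M\in\mathcal{M}_{n/2}(C_n)}\prod_{e\in M}g(\varphi(e))-\big(\varphi(C)+f(\varphi(C))\big)$$ if $n$ is even.
   Context: An anti-involution of $F^\times$ is a map $f:F^\times\to F^\times$ with $f(f(x))=x$ and $f(xy)=f(y)f(x)$. A skew gain graph $(G,F^\times,\varphi,f)$ is a simple graph $G$ with vertices $v_1,\dots,v_n$ and a function $\varphi$ on oriented edges (both orientations of each edge) with values in $F^\times$ satisfying $\varphi(\overrightarrow{vu})=f(\varphi(\overrightarrow{uv}))$. Its adjacency matrix $A$ has $(i,j)$ entry $\varphi(\overrightarrow{v_iv_j})$ if $v_i\sim v_j$ and $0$ otherwise. $g(x)=xf(x)$, and for an edge $e=uv$, $g(\varphi(e))$ means $g(\varphi(\overrightarrow{uv}))$ (which equals $g(\varphi(\overrightarrow{vu}))$). For the cycle $C:v_0v_1\cdots v_{n-1}v_0$, $\varphi(C)=\varphi(\overrightarrow{v_0v_1})\cdots\varphi(\overrightarrow{v_{n-1}v_0})$. $\mathcal{M}_k(G)$ is the set of matchings of $G$ with exactly $k$ edges. -}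

module Defs where

open import Level using (_⊔_)
open import Algebra.Bundles using (CommutativeRing)
open import Data.Nat using (ℕ; zero; suc)
open import Data.Nat.DivMod using (_mod_)
open import Data.Fin using (Fin; zero; suc; toℕ; punchIn; _≟_)
open import Data.Fin.Subset using (Subset; _∈_; ∣_∣; inside; outside)
open import Data.Fin.Subset.Properties using (_∈?_)
open import Data.Fin.Properties using (all?)
open import Data.Vec using (_∷_; [])
open import Data.List using (List; []; _∷_; map; _++_; filter; foldr)
open import Data.Product using (_×_; ∃)
open import Data.Sum using (_⊎_)
open import Relation.Binary.PropositionalEquality using (_≡_; _≢_)
open import Relation.Nullary using (¬_; Dec; does)
open import Relation.Nullary.Decidable using (_×-dec_; _⊎-dec_; _→-dec_; ¬?)
open import Data.Nat.Properties using () renaming (_≟_ to _≟ℕ_)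
open import Data.Bool using (if_then_else_)

next : ∀ {n} → Fin n → Fin n
next {suc m} i = suc (toℕ i) mod suc m

CycleAdj : ∀ {n} → Fin n → Fin n → Set
CycleAdj i j = (j ≡ next i) ⊎ (i ≡ next j)

cycleAdj? : ∀ {n} (i j : Fin n) → Dec (CycleAdj i j)
cycleAdj? i j = (j ≟ next i) ⊎-dec (i ≟ next j)

-- Matchings of C_n: the edges of C_n are e_i = v_i v_{next i}, i : Fin n.
-- A set S of edges is a matching with exactly k edges if |S| = k and
-- any two distinct edges of S share no endpoint.
Disjoint : ∀ {n} → Fin n → Fin n → Set
Disjoint i j = (i ≢ j) × (i ≢ next j) × (next i ≢ j) × (next i ≢ next j)

IsMatching : ∀ {n} → ℕ → Subset n → Set
IsMatching {n} k S = (∣ S ∣ ≡ k) × (∀ i j → i ∈ S → j ∈ S → i ≢ j → Disjoint i j)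

isMatching? : ∀ {n} k (S : Subset n) → Dec (IsMatching k S)
isMatching? k S =
  (∣ S ∣ ≟ℕ k) ×-dec
  all? (λ i → all? (λ j → (i ∈? S) →-dec ((j ∈? S) →-dec ((¬? (i ≟ j)) →-dec
     (¬? (i ≟ j) ×-dec ¬? (i ≟ next j) ×-dec ¬? (next i ≟ j) ×-dec ¬? (next i ≟ next j))))))

allSubsets : ∀ n → List (Subset n)
allSubsets zero = [] ∷ []
allSubsets (suc n) = map (inside ∷_) (allSubsets n) ++ map (outside ∷_) (allSubsets n)

matchings : ∀ n → ℕ → List (Subset n)
matchings n k = filter (isMatching? k) (allSubsets n)

module _ {c ℓ} (R : CommutativeRing c ℓ) where
  open CommutativeRing R hiding (zero)

  IsField : Set (c ⊔ ℓ)
  IsField = (¬ (1# ≈ 0#)) × (∀ x → ¬ (x ≈ 0#) → ∃ λ y → x * y ≈ 1#)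

  natF : ℕ → Carrier
  natF zero = 0#
  natF (suc m) = 1# + natF m

  CharZero : Set ℓ
  CharZero = ∀ m → ¬ (natF (suc m) ≈ 0#)

  -- f : Carrier → Carrier, considered on F^× = {x | x ≉ 0}: a well-defined
  -- map F^× → F^× with f (f x) = x and f (x y) = f y f x.
  IsAntiInvolution : (Carrier → Carrier) → Set (c ⊔ ℓ)
  IsAntiInvolution f =
    (∀ x y → ¬ (x ≈ 0#) → x ≈ y → f x ≈ f y) ×
    (∀ x → ¬ (x ≈ 0#) → ¬ (f x ≈ 0#)) ×
    (∀ x → ¬ (x ≈ 0#) → f (f x) ≈ x) ×
    (∀ x y → ¬ (x ≈ 0#) → ¬ (y ≈ 0#) → f (x * y) ≈ f y * f x)

  IsSkewGain : ∀ {n} → (Carrier → Carrier) → (Fin n → Fin n → Set) →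
               (Fin n → Fin n → Carrier) → Set ℓ
  IsSkewGain f Adj φ =
    (∀ i j → Adj i j → ¬ (φ i j ≈ 0#)) × (∀ i j → Adj i j → φ j i ≈ f (φ i j))

  adjMatrix : ∀ {n} {Adj : Fin n → Fin n → Set} → (∀ i j → Dec (Adj i j)) →
              (Fin n → Fin n → Carrier) → Fin n → Fin n → Carrier
  adjMatrix adj? φ i j = if does (adj? i j) then φ i j else 0#

  sumF : ∀ {n} → (Fin n → Carrier) → Carrier
  sumF {zero} v = 0#
  sumF {suc n} v = v zero + sumF (λ i → v (suc i))

  prodF : ∀ {n} → (Fin n → Carrier) → Carrier
  prodF {zero} v = 1#
  prodF {suc n} v = v zero * prodF (λ i → v (suc i))

  sumL : List Carrier → Carrier
  sumL = foldr _+_ 0#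

  signF : ℕ → Carrier
  signF zero = 1#
  signF (suc k) = - signF k

  det : ∀ {n} → (Fin n → Fin n → Carrier) → Carrier
  det {zero} M = 1#
  det {suc n} M =
    sumF (λ j → signF (toℕ j) * (M zero j * det (λ r s → M (suc r) (punchIn j s))))

  cycleGain : ∀ {n} → (Fin n → Fin n → Carrier) → Carrier
  cycleGain φ = prodF (λ i → φ i (next i))

  -- Σ_{M ∈ 𝓜_k(C_n)} Π_{e ∈ M} g(φ(e)),  g(x) = x f(x),  e_i = v_i v_{next i}
  matchingSum : ∀ n → (Carrier → Carrier) → (Fin n → Fin n → Carrier) → ℕ → Carrier
  matchingSum n f φ k =
    sumL (map (λ S → prodF (λ i → if does (i ∈? S) then φ i (next i) * f (φ i (next i)) else 1#))
              (matchings n k))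

module Submission where

-- Write the adjacency matrix A of the cycle v₀ v₁ ⋯ v_L v₀ (n = L + 1) as P + E, where P is the
-- adjacency matrix of the path v₀ v₁ ⋯ v_L and E holds the two corner entries φ(v₀v_L) and φ(v_Lv₀).
-- Since the determinant is additive in rows 0 and L, det A splits into four determinants: det P,
-- two triangular ones equal to (-1)^L φ(C) and (-1)^L f(φ(C)) (f reverses products, which does not
-- matter in a commutative ring), and one that reduces to the path v₁ ⋯ v_{L-1}. Expanding a path
-- determinant along its first row shows that it vanishes on an odd number of vertices and equals
-- (-1)^k ∏ g(φ(e)) over the unique perfect matching on 2k vertices. For n odd only the two
-- triangular terms survive. For n = 2k the two path terms are the products over the even and the odd
-- edges of the cycle, and a matching of C_n with k edges has no two consecutive edges, so these two
-- alternating edge sets are exactly the elements of 𝓜_k(C_n).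

open import Defs
open import Algebra.Bundles using (CommutativeRing)
import Algebra.Properties.CommutativeMonoid.Sum as CommutativeMonoidSum
import Algebra.Properties.Semiring.Sum as SemiringSum
open import Data.Bool using (Bool; true; false; not; if_then_else_)
import Data.Bool.Properties as Bool
open import Data.Bool.Properties using (not-involutive; not-¬)
open import Data.Empty using (⊥; ⊥-elim)
open import Data.Fin as Fin using (Fin; zero; suc; toℕ; punchIn; inject₁; fromℕ)
open import Data.Fin.Properties
  using ( punchInᵢ≢i; toℕ-fromℕ<; toℕ-fromℕ; toℕ-injective; toℕ<n; toℕ-inject₁; fromℕ≢inject₁
        ; suc-injective)
open import Data.Fin.Subset using (Subset; Side; inside; outside; _∈_; ∣_∣)
open import Data.Fin.Subset.Properties using (_∈?_)
open import Data.List as List using ([]; _∷_; filter)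
import Data.List.Properties as List
open import Data.Nat as ℕ using (ℕ; zero; suc; _<_; z<s; s<s)
import Data.Nat.Properties as ℕ
open import Data.Nat.DivMod using (_%_; m<n⇒m%n≡m; n%n≡0)
open import Data.Product using (_×_; _,_; proj₁; proj₂; ∃)
open import Data.Sum using (_⊎_; inj₁; inj₂; [_,_])
open import Data.Vec using ([]; _∷_; here; there)
open import Data.Vec.Functional using (removeAt)
open import Data.Vec.Properties using (≡-dec)
open import Function using (_∘_)
open import Relation.Binary.Definitions using (DecidableEquality)
open import Relation.Binary.PropositionalEquality as ≡ using (_≡_; _≢_)
open import Relation.Nullary using (Dec; does; yes; no; ¬_)
open import Relation.Nullary.Decidable using (_⊎-dec_; _×-dec_; dec-true)
open import Relation.Unary using (Pred; Decidable)

double : ℕ → ℕ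
double zero    = zero
double (suc k) = suc (suc (double k))

double≡2* : ∀ k → double k ≡ 2 ℕ.* k
double≡2* zero    = ≡.refl
double≡2* (suc k) =
  ≡.cong suc (≡.trans (≡.cong suc (double≡2* k)) (≡.sym (ℕ.+-suc k (k ℕ.+ 0))))

alternating : Side → ∀ n → Subset n
alternating b zero    = []
alternating b (suc n) = b ∷ alternating (not b) n

Consecutive : ℕ → ℕ → Set
Consecutive a b = b ≡ suc a ⊎ a ≡ suc b

consecutive? : ∀ a b → Dec (Consecutive a b)
consecutive? a b = (b ℕ.≟ suc a) ⊎-dec (a ℕ.≟ suc b)

consecutive-sym : ∀ {a b} → Consecutive a b → Consecutive b a
consecutive-sym (inj₁ b≡1+a) = inj₂ b≡1+a
consecutive-sym (inj₂ a≡1+b) = inj₁ a≡1+b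

consecutive-suc : ∀ {a b} → Consecutive (suc a) (suc b) → Consecutive a b
consecutive-suc (inj₁ e) = inj₁ (ℕ.suc-injective e)
consecutive-suc (inj₂ e) = inj₂ (ℕ.suc-injective e)

consecutive-suc⁻¹ : ∀ {a b} → Consecutive a b → Consecutive (suc a) (suc b)
consecutive-suc⁻¹ (inj₁ e) = inj₁ (≡.cong suc e)
consecutive-suc⁻¹ (inj₂ e) = inj₂ (≡.cong suc e)

<⇒¬consecutive-suc : ∀ {a b} → a < b → ¬ Consecutive a (suc b)
<⇒¬consecutive-suc a<b (inj₁ 1+b≡1+a) = ℕ.<⇒≢ a<b (≡.sym (ℕ.suc-injective 1+b≡1+a))
<⇒¬consecutive-suc a<b (inj₂ ≡.refl)  = ℕ.<-asym a<b (ℕ.m<n⇒m<1+n ℕ.≤-refl)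

inject₁≢fromℕ : ∀ {n} (i : Fin n) → inject₁ i ≢ fromℕ n
inject₁≢fromℕ i = fromℕ≢inject₁ ∘ ≡.sym

punchIn-fromℕ : ∀ {n} (i : Fin n) → punchIn (fromℕ n) i ≡ inject₁ i
punchIn-fromℕ zero    = ≡.refl
punchIn-fromℕ (suc i) = ≡.cong suc (punchIn-fromℕ i)

module FiniteSums {c ℓ} (R : CommutativeRing c ℓ) where
  open CommutativeRing R hiding (zero)
  open SemiringSum semiring
    using (sum; sum-cong-≋; sum-remove; ∑-distrib-+; *-distribˡ-sum; sum-replicate-zero)
  private module Product = CommutativeMonoidSum *-commutativeMonoid

  sumF≡sum : ∀ {n} (v : Fin n → Carrier) → sumF R v ≡ sum v
  sumF≡sum {zero}  v = ≡.refl
  sumF≡sum {suc n} v = ≡.cong (v zero +_) (sumF≡sum (λ i → v (suc i)))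

  prodF≡product : ∀ {n} (v : Fin n → Carrier) → prodF R v ≡ Product.sum v
  prodF≡product {zero}  v = ≡.refl
  prodF≡product {suc n} v = ≡.cong (v zero *_) (prodF≡product (λ i → v (suc i)))

  sumF-cong : ∀ {n} {v w : Fin n → Carrier} → (∀ i → v i ≈ w i) → sumF R v ≈ sumF R w
  sumF-cong {v = v} {w} v≈w rewrite sumF≡sum v | sumF≡sum w = sum-cong-≋ v≈w

  sumF-zero : ∀ {n} {v : Fin n → Carrier} → (∀ i → v i ≈ 0#) → sumF R v ≈ 0#
  sumF-zero {n} {v} v≈0 rewrite sumF≡sum v =
    trans (sum-cong-≋ v≈0) (sum-replicate-zero n)

  sumF-single : ∀ {n} (v : Fin (suc n) → Carrier) c → (∀ j → j ≢ c → v j ≈ 0#) →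
                sumF R v ≈ v c
  sumF-single v c others≈0 = begin
    sumF R v                     ≡⟨ sumF≡sum v ⟩
    sum v                        ≈⟨ sum-remove {i = c} v ⟩
    v c + sum (removeAt v c)     ≡⟨ ≡.cong (v c +_) (sumF≡sum (removeAt v c)) ⟨
    v c + sumF R (removeAt v c)  ≈⟨ +-congˡ (sumF-zero λ j → others≈0 _ (punchInᵢ≢i c j)) ⟩
    v c + 0#                     ≈⟨ +-identityʳ (v c) ⟩
    v c                          ∎
    where open import Relation.Binary.Reasoning.Setoid setoid

  sumF-+ : ∀ {n} (v w : Fin n → Carrier) → sumF R (λ i → v i + w i) ≈ sumF R v + sumF R w
  sumF-+ v w rewrite sumF≡sum v | sumF≡sum w | sumF≡sum (λ i → v i + w i) =
    ∑-distrib-+ v w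

  *-distribˡ-sumF : ∀ {n} x (v : Fin n → Carrier) → x * sumF R v ≈ sumF R (λ i → x * v i)
  *-distribˡ-sumF x v rewrite sumF≡sum v | sumF≡sum (λ i → x * v i) = *-distribˡ-sum x v

  prodF-cong : ∀ {n} {v w : Fin n → Carrier} → (∀ i → v i ≈ w i) → prodF R v ≈ prodF R w
  prodF-cong {v = v} {w} v≈w rewrite prodF≡product v | prodF≡product w =
    Product.sum-cong-≋ v≈w

  prodF-init-last : ∀ {n} (v : Fin (suc n) → Carrier) →
                    prodF R v ≈ prodF R (λ i → v (inject₁ i)) * v (fromℕ n)
  prodF-init-last v rewrite prodF≡product v | prodF≡product (λ i → v (inject₁ i)) =
    Product.sum-init-last v

  productOver : ∀ {n} → Subset n → (Fin n → Carrier) → Carrier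
  productOver S w = prodF R (λ i → if does (i ∈? S) then w i else 1#)

module Determinant {c ℓ} (R : CommutativeRing c ℓ) where
  open CommutativeRing R hiding (zero)
  open FiniteSums R
  open import Relation.Binary.Reasoning.Setoid setoid
  open import Algebra.Properties.Ring ring using (-‿distribˡ-*; -‿involutive)
  open import Algebra.Solver.CommutativeMonoid *-commutativeMonoid
    using (solve; _⊜_) renaming (_⊕_ to _⊗_)

  Matrix : ℕ → Set c
  Matrix n = Fin n → Fin n → Carrier

  minor : ∀ {n} → Matrix (suc n) → Fin (suc n) → Matrix n
  minor M j r s = M (suc r) (punchIn j s)

  laplaceTerm : ∀ {n} → Matrix (suc n) → Fin (suc n) → Carrier
  laplaceTerm M j = signF R (toℕ j) * (M zero j * det R (minor M j))

  laplaceTerm-entry≈0 : ∀ {n} (M : Matrix (suc n)) j → M zero j ≈ 0# → laplaceTerm M j ≈ 0#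
  laplaceTerm-entry≈0 M j entry≈0 =
    trans (*-congˡ (trans (*-congʳ entry≈0) (zeroˡ _))) (zeroʳ _)

  laplaceTerm-minor≈0 : ∀ {n} (M : Matrix (suc n)) j → det R (minor M j) ≈ 0# →
                        laplaceTerm M j ≈ 0#
  laplaceTerm-minor≈0 M j minor≈0 =
    trans (*-congˡ (trans (*-congˡ minor≈0) (zeroʳ _))) (zeroʳ _)

  det-cong : ∀ {n} {M N : Matrix n} → (∀ i j → M i j ≈ N i j) → det R M ≈ det R N
  det-cong {zero}  _   = refl
  det-cong {suc n} {M} {N} M≈N = sumF-cong {v = laplaceTerm M} {laplaceTerm N} λ j →
    *-congˡ (*-cong (M≈N zero j) (det-cong λ r s → M≈N (suc r) (punchIn j s)))

  det-zero-row : ∀ {n} (M : Matrix n) p → (∀ j → M p j ≈ 0#) → det R M ≈ 0#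
  det-zero-row M zero    row≈0 =
    sumF-zero {v = laplaceTerm M} λ j → laplaceTerm-entry≈0 M j (row≈0 j)
  det-zero-row M (suc p) row≈0 = sumF-zero {v = laplaceTerm M} λ j →
    laplaceTerm-minor≈0 M j (det-zero-row (minor M j) p (λ s → row≈0 (punchIn j s)))

  det-zero-firstColumn : ∀ {n} (M : Matrix (suc n)) → (∀ i → M i zero ≈ 0#) → det R M ≈ 0#
  det-zero-firstColumn {zero}  M column≈0 =
    trans (+-identityʳ _) (laplaceTerm-entry≈0 M zero (column≈0 zero))
  det-zero-firstColumn {suc n} M column≈0 = sumF-zero {v = laplaceTerm M} λ where
    zero    → laplaceTerm-entry≈0 M zero (column≈0 zero)
    (suc j) → laplaceTerm-minor≈0 M (suc j)
                (det-zero-firstColumn (minor M (suc j)) λ r → column≈0 (suc r))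

  det-expand-firstRow : ∀ {n} (M : Matrix (suc n)) c → (∀ j → j ≢ c → M zero j ≈ 0#) →
                        det R M ≈ signF R (toℕ c) * (M zero c * det R (minor M c))
  det-expand-firstRow M c others≈0 =
    sumF-single (laplaceTerm M) c λ j j≢c → laplaceTerm-entry≈0 M j (others≈0 j j≢c)

  det-expand-firstColumn : ∀ {n} (M : Matrix (suc n)) → (∀ i → M (suc i) zero ≈ 0#) →
                           det R M ≈ M zero zero * det R (λ r s → M (suc r) (suc s))
  det-expand-firstColumn M below≈0 = begin
    laplaceTerm M zero + sumF R (λ j → laplaceTerm M (suc j)) ≈⟨ +-congˡ (tail≈0 M below≈0) ⟩
    laplaceTerm M zero + 0#                                   ≈⟨ +-identityʳ _ ⟩
    1# * (M zero zero * det R (minor M zero))                 ≈⟨ *-identityˡ _ ⟩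
    M zero zero * det R (λ r s → M (suc r) (suc s))           ∎
    where
    tail≈0 : ∀ {n} (M : Matrix (suc n)) → (∀ i → M (suc i) zero ≈ 0#) →
             sumF R (λ j → laplaceTerm M (suc j)) ≈ 0#
    tail≈0 {zero}  M _       = refl
    tail≈0 {suc n} M below≈0 = sumF-zero {v = λ j → laplaceTerm M (suc j)} λ j →
      laplaceTerm-minor≈0 M (suc j) (det-zero-firstColumn (minor M (suc j)) below≈0)

  -- For j ≠ 0 the last row of the first-row minor at j is again concentrated in column 0, and deleting
  -- it there leaves the first-row minor at j - 1 of the matrix on the right.
  det-expand-lastRow : ∀ {n} (M : Matrix (suc n)) → (∀ j → j ≢ zero → M (fromℕ n) j ≈ 0#) →
                       det R M ≈ signF R n * (M (fromℕ n) zero * det R (λ r s → M (inject₁ r) (suc s)))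
  det-expand-lastRow {zero}  M _        = +-identityʳ _
  det-expand-lastRow {suc n} M others≈0 = begin
    laplaceTerm M zero + sumF R (λ j → laplaceTerm M (suc j))
      ≈⟨ +-cong (laplaceTerm-minor≈0 M zero first-minor≈0)
                (sumF-cong {v = λ j → laplaceTerm M (suc j)} λ j → *-congˡ (*-congˡ (expand-minor j))) ⟩
    0# + sumF R (λ j → - σ j * (a j * (σₙ * (x * d j))))  ≈⟨ +-identityˡ _ ⟩
    sumF R (λ j → - σ j * (a j * (σₙ * (x * d j))))
      ≈⟨ sumF-cong {v = λ j → - σ j * (a j * (σₙ * (x * d j)))} (λ j → move-sign (σ j) (a j) σₙ x (d j)) ⟩
    sumF R (λ j → (- σₙ * x) * (σ j * (a j * d j)))
      ≈⟨ *-distribˡ-sumF (- σₙ * x) (λ j → σ j * (a j * d j)) ⟨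
    (- σₙ * x) * det R (λ r s → M (inject₁ r) (suc s))    ≈⟨ *-assoc _ _ _ ⟩
    - σₙ * (x * det R (λ r s → M (inject₁ r) (suc s)))    ∎
    where
    σ : Fin (suc n) → Carrier
    σ j = signF R (toℕ j)
    σₙ = signF R n
    a : Fin (suc n) → Carrier
    a j = M zero (suc j)
    x = M (fromℕ (suc n)) zero
    d : Fin (suc n) → Carrier
    d j = det R (λ r s → M (suc (inject₁ r)) (suc (punchIn j s)))
    first-minor≈0 : det R (minor M zero) ≈ 0#
    first-minor≈0 = det-zero-row (minor M zero) (fromℕ n) λ s → others≈0 (suc s) λ ()
    expand-minor : ∀ j → det R (minor M (suc j)) ≈ σₙ * (x * d j)
    expand-minor j = det-expand-lastRow (minor M (suc j)) λ where
      zero    0≢0 → ⊥-elim (0≢0 ≡.refl)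
      (suc s) _   → others≈0 _ λ ()
    move-sign : ∀ s a t x d → - s * (a * (t * (x * d))) ≈ (- t * x) * (s * (a * d))
    move-sign s a t x d = begin
      - s * (a * (t * (x * d)))    ≈⟨ -‿distribˡ-* s _ ⟨
      - (s * (a * (t * (x * d))))
        ≈⟨ -‿cong (solve 5 (λ s a t x d → s ⊗ (a ⊗ (t ⊗ (x ⊗ d))) ⊜ (t ⊗ x) ⊗ (s ⊗ (a ⊗ d))) refl s a t x d) ⟩
      - ((t * x) * (s * (a * d)))  ≈⟨ -‿distribˡ-* (t * x) _ ⟩
      - (t * x) * (s * (a * d))    ≈⟨ *-congʳ (-‿distribˡ-* t x) ⟩
      (- t * x) * (s * (a * d))    ∎

  setRow : ∀ {n} → Fin n → (Fin n → Carrier) → Matrix n → Matrix n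
  setRow p row M i j = if does (i Fin.≟ p) then row j else M i j

  setRow-at : ∀ {n} p (row : Fin n → Carrier) M j → setRow p row M p j ≡ row j
  setRow-at p row M j rewrite dec-true (p Fin.≟ p) ≡.refl = ≡.refl

  setRow-off : ∀ {n} {p i} (row : Fin n → Carrier) M j → i ≢ p → setRow p row M i j ≡ M i j
  setRow-off {p = p} {i} row M j i≢p with i Fin.≟ p
  ... | yes i≡p = ⊥-elim (i≢p i≡p)
  ... | no  _   = ≡.refl

  setRow-comm : ∀ {n} {p q : Fin n} → p ≢ q → ∀ row row′ M i j →
                setRow p row (setRow q row′ M) i j ≡ setRow q row′ (setRow p row M) i j
  setRow-comm {p = p} {q} p≢q row row′ M i j with i Fin.≟ p | i Fin.≟ q
  ... | yes i≡p | yes i≡q = ⊥-elim (p≢q (≡.trans (≡.sym i≡p) i≡q))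
  ... | yes _   | no _    = ≡.refl
  ... | no _    | yes _   = ≡.refl
  ... | no _    | no _    = ≡.refl

  -- The first-row minors of setRow (suc p) row M are the first-row minors of M with row p replaced.
  det-setRow-+ : ∀ {n} p (row row′ : Fin n → Carrier) (M : Matrix n) →
                 det R (setRow p (λ j → row j + row′ j) M) ≈ det R (setRow p row M) + det R (setRow p row′ M)
  det-setRow-+ {suc n} p row row′ M =
    trans (sumF-cong {v = laplaceTerm (setRow p (λ j → row j + row′ j) M)} (laplaceTerm-+ p))
          (sumF-+ (laplaceTerm (setRow p row M)) (laplaceTerm (setRow p row′ M)))
    where
    laplaceTerm-+ : ∀ p j → laplaceTerm (setRow p (λ j → row j + row′ j) M) j ≈
                            laplaceTerm (setRow p row M) j + laplaceTerm (setRow p row′ M) j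
    laplaceTerm-+ zero    j = trans (*-congˡ (distribʳ _ (row j) (row′ j))) (distribˡ _ _ _)
    laplaceTerm-+ (suc p) j =
      trans (*-congˡ (*-congˡ (det-setRow-+ p (λ s → row (punchIn j s)) (λ s → row′ (punchIn j s)) (minor M j))))
            (trans (*-congˡ (distribˡ _ _ _)) (distribˡ _ _ _))

  det-upperTriangular : ∀ {n} (M : Matrix n) → (∀ i j → toℕ j < toℕ i → M i j ≈ 0#) →
                        det R M ≈ prodF R (λ i → M i i)
  det-upperTriangular {zero}  M _     = refl
  det-upperTriangular {suc n} M below≈0 =
    trans (det-expand-firstColumn M λ i → below≈0 (suc i) zero z<s)
          (*-congˡ (det-upperTriangular _ λ i j j<i → below≈0 (suc i) (suc j) (s<s j<i)))

  det-lowerTriangular : ∀ {n} (M : Matrix n) → (∀ i j → toℕ i < toℕ j → M i j ≈ 0#) →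
                        det R M ≈ prodF R (λ i → M i i)
  det-lowerTriangular {zero}  M _     = refl
  det-lowerTriangular {suc n} M above≈0 =
    trans (det-expand-firstRow M zero λ where
             zero    0≢0 → ⊥-elim (0≢0 ≡.refl)
             (suc j) _   → above≈0 zero (suc j) z<s)
          (trans (*-identityˡ _)
                 (*-congˡ (det-lowerTriangular _ λ i j i<j → above≈0 (suc i) (suc j) (s<s i<j))))

  signF-double : ∀ k → signF R (double k) ≈ 1#
  signF-double zero    = refl
  signF-double (suc k) = trans (-‿involutive _) (signF-double k)

module AdjacencyMatrix {c ℓ} (R : CommutativeRing c ℓ) where
  open CommutativeRing R hiding (zero)

  module _ {n} {Adj : Fin n → Fin n → Set} (adj? : ∀ i j → Dec (Adj i j))
           (φ : Fin n → Fin n → Carrier) where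

    adjMatrix-adj : ∀ {i j} → Adj i j → adjMatrix R adj? φ i j ≡ φ i j
    adjMatrix-adj {i} {j} adj with adj? i j
    ... | yes _    = ≡.refl
    ... | no ¬adj = ⊥-elim (¬adj adj)

    adjMatrix-nonadj : ∀ {i j} → ¬ Adj i j → adjMatrix R adj? φ i j ≡ 0#
    adjMatrix-nonadj {i} {j} ¬adj with adj? i j
    ... | yes adj = ⊥-elim (¬adj adj)
    ... | no _    = ≡.refl

    adjMatrix-⊎ : ∀ {A₁ A₂ : Fin n → Fin n → Set}
                  (a₁? : ∀ i j → Dec (A₁ i j)) (a₂? : ∀ i j → Dec (A₂ i j)) {i j} →
                  (Adj i j → A₁ i j ⊎ A₂ i j) → (A₁ i j ⊎ A₂ i j → Adj i j) → (A₁ i j → ¬ A₂ i j) →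
                  adjMatrix R adj? φ i j ≈ adjMatrix R a₁? φ i j + adjMatrix R a₂? φ i j
    adjMatrix-⊎ a₁? a₂? {i} {j} split join disjoint with adj? i j | a₁? i j | a₂? i j
    ... | yes _   | yes a₁ | yes a₂ = ⊥-elim (disjoint a₁ a₂)
    ... | yes _   | yes _  | no _   = sym (+-identityʳ _)
    ... | yes _   | no _   | yes _  = sym (+-identityˡ _)
    ... | yes adj | no ¬a₁ | no ¬a₂ = ⊥-elim ([ ¬a₁ , ¬a₂ ] (split adj))
    ... | no ¬adj | yes a₁ | _      = ⊥-elim (¬adj (join (inj₁ a₁)))
    ... | no ¬adj | no _   | yes a₂ = ⊥-elim (¬adj (join (inj₂ a₂)))
    ... | no _    | no _   | no _   = sym (+-identityˡ 0#)

module PathMatrix {c ℓ} (R : CommutativeRing c ℓ) where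
  open CommutativeRing R hiding (zero)
  open FiniteSums R
  open Determinant R
  open AdjacencyMatrix R
  open import Relation.Binary.Reasoning.Setoid setoid
  open import Algebra.Properties.Ring ring using (-‿distribˡ-*; -1*x≈-x)
  open import Algebra.Solver.CommutativeMonoid *-commutativeMonoid
    using (solve; _⊜_) renaming (_⊕_ to _⊗_)

  PathAdj : ∀ {n} → Fin n → Fin n → Set
  PathAdj i j = Consecutive (toℕ i) (toℕ j)

  pathAdj? : ∀ {n} (i j : Fin n) → Dec (PathAdj i j)
  pathAdj? i j = consecutive? (toℕ i) (toℕ j)

  pathMatrix : ∀ {n} → Matrix n → Matrix n
  pathMatrix = adjMatrix R pathAdj?

  shift₂ : ∀ {n} → Matrix (suc (suc n)) → Matrix n
  shift₂ ψ r s = ψ (suc (suc r)) (suc (suc s))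

  det-pathMatrix-step : ∀ {n} (ψ : Matrix (suc (suc n))) →
    det R (pathMatrix ψ) ≈ - (ψ zero (suc zero) * ψ (suc zero) zero) * det R (pathMatrix (shift₂ ψ))
  det-pathMatrix-step ψ = begin
    det R P
      ≈⟨ det-expand-firstRow P (suc zero) (λ where
           zero          _   → refl
           (suc zero)    1≢1 → ⊥-elim (1≢1 ≡.refl)
           (suc (suc j)) _   → refl) ⟩
    - 1# * (a * det R (minor P (suc zero)))
      ≈⟨ *-congˡ (*-congˡ (det-expand-firstColumn (minor P (suc zero)) λ i → refl)) ⟩
    - 1# * (a * (b * d))   ≈⟨ -1*x≈-x _ ⟩
    - (a * (b * d))        ≈⟨ -‿cong (*-assoc a b d) ⟨
    - (a * b * d)          ≈⟨ -‿distribˡ-* (a * b) d ⟩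
    - (a * b) * d          ∎
    where
    P = pathMatrix ψ
    a = ψ zero (suc zero)
    b = ψ (suc zero) zero
    d = det R (pathMatrix (shift₂ ψ))

  det-pathMatrix-odd : ∀ k (ψ : Matrix (suc (double k))) → det R (pathMatrix ψ) ≈ 0#
  det-pathMatrix-odd zero    ψ = trans (+-identityʳ _) (trans (*-identityˡ _) (zeroˡ _))
  det-pathMatrix-odd (suc k) ψ =
    trans (det-pathMatrix-step ψ) (trans (*-congˡ (det-pathMatrix-odd k (shift₂ ψ))) (zeroʳ _))

  -- w i is the weight ψ i (i+1) * ψ (i+1) i of the edge leaving i; it is taken as an argument
  -- because Fin (double k) has no total successor in which to express it.
  det-pathMatrix-even : ∀ k (ψ : Matrix (double k)) (w : Fin (double k) → Carrier) →
    (∀ i j → toℕ j ≡ suc (toℕ i) → w i ≈ ψ i j * ψ j i) →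
    det R (pathMatrix ψ) ≈ signF R k * productOver (alternating inside (double k)) w
  det-pathMatrix-even zero    ψ w _      = sym (*-identityˡ 1#)
  det-pathMatrix-even (suc k) ψ w w≈ψψ = begin
    det R (pathMatrix ψ)             ≈⟨ det-pathMatrix-step ψ ⟩
    - (a * b) * det R (pathMatrix (shift₂ ψ))
      ≈⟨ *-cong (-‿cong (sym (w≈ψψ zero (suc zero) ≡.refl)))
                (det-pathMatrix-even k (shift₂ ψ) (λ i → w (suc (suc i)))
                  λ i j j≡1+i → w≈ψψ (suc (suc i)) (suc (suc j)) (≡.cong (λ m → suc (suc m)) j≡1+i)) ⟩
    - w₀ * (signF R k * π)           ≈⟨ -‿distribˡ-* w₀ _ ⟨
    - (w₀ * (signF R k * π))         ≈⟨ -‿cong (solve 3 (λ x s p → x ⊗ (s ⊗ p) ⊜ s ⊗ (x ⊗ p))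
                                                         refl w₀ (signF R k) π) ⟩
    - (signF R k * (w₀ * π))         ≈⟨ -‿distribˡ-* (signF R k) _ ⟩
    - signF R k * (w₀ * π)           ≈⟨ *-congˡ (*-congˡ (*-identityˡ π)) ⟨
    - signF R k * (w₀ * (1# * π))    ∎
    where
    a = ψ zero (suc zero)
    b = ψ (suc zero) zero
    w₀ = w zero
    π = productOver (alternating inside (double k)) (λ i → w (suc (suc i)))

  pathMatrix-shift : ∀ {m n} (σ : Fin m → Fin n) → (∀ i → toℕ (σ i) ≡ suc (toℕ i)) → (ψ : Matrix n) →
                     ∀ r s → pathMatrix ψ (σ r) (σ s) ≡ pathMatrix (λ r s → ψ (σ r) (σ s)) r s
  pathMatrix-shift σ toℕ-σ ψ r s with pathAdj? r s
  ... | yes adj = ≡.trans (adjMatrix-adj pathAdj? ψ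
                              (≡.subst₂ Consecutive (≡.sym (toℕ-σ r)) (≡.sym (toℕ-σ s)) (consecutive-suc⁻¹ adj)))
                            (≡.sym (adjMatrix-adj pathAdj? (λ r s → ψ (σ r) (σ s)) adj))
  ... | no ¬adj = ≡.trans (adjMatrix-nonadj pathAdj? ψ
                              λ adj → ¬adj (consecutive-suc (≡.subst₂ Consecutive (toℕ-σ r) (toℕ-σ s) adj)))
                            (≡.sym (adjMatrix-nonadj pathAdj? (λ r s → ψ (σ r) (σ s)) ¬adj))

  det-pathMatrix-superdiagonal : ∀ {m} (ψ : Matrix (suc m)) →
    det R (λ r s → pathMatrix ψ (inject₁ r) (suc s)) ≈ prodF R (λ r → ψ (inject₁ r) (suc r))
  det-pathMatrix-superdiagonal ψ =
    trans (det-lowerTriangular _ λ r s r<s → reflexive (adjMatrix-nonadj pathAdj? ψ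
            (<⇒¬consecutive-suc r<s ∘ ≡.subst (λ a → Consecutive a _) (toℕ-inject₁ r))))
          (prodF-cong λ r →
            reflexive (adjMatrix-adj pathAdj? ψ (inj₁ (≡.cong suc (≡.sym (toℕ-inject₁ r))))))

  det-pathMatrix-subdiagonal : ∀ {m} (ψ : Matrix (suc m)) →
    det R (λ r s → pathMatrix ψ (suc r) (inject₁ s)) ≈ prodF R (λ r → ψ (suc r) (inject₁ r))
  det-pathMatrix-subdiagonal ψ =
    trans (det-upperTriangular _ λ r s s<r → reflexive (adjMatrix-nonadj pathAdj? ψ
            (<⇒¬consecutive-suc s<r ∘ ≡.subst (λ a → Consecutive a _) (toℕ-inject₁ s) ∘ consecutive-sym)))
          (prodF-cong λ r →
            reflexive (adjMatrix-adj pathAdj? ψ (inj₂ (≡.cong suc (≡.sym (toℕ-inject₁ r))))))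

module CycleIndexing where
  open ≡.≡-Reasoning

  toℕ-next-< : ∀ {m} {i : Fin (suc m)} → toℕ i < m → toℕ (next i) ≡ suc (toℕ i)
  toℕ-next-< {m} {i} i<m = ≡.trans (toℕ-fromℕ< _) (m<n⇒m%n≡m (s<s i<m))

  next-suc : ∀ {n} {i j : Fin n} → toℕ j ≡ suc (toℕ i) → next i ≡ j
  next-suc {suc m} {i} {j} j≡1+i = toℕ-injective (begin
    toℕ (next i)  ≡⟨ toℕ-next-< (ℕ.s<s⁻¹ (≡.subst (_< suc m) j≡1+i (toℕ<n j))) ⟩
    suc (toℕ i)   ≡⟨ j≡1+i ⟨
    toℕ j         ∎)

  next-fromℕ : ∀ m → next (fromℕ m) ≡ zero
  next-fromℕ m = toℕ-injective (begin
    toℕ (next (fromℕ m))        ≡⟨ toℕ-fromℕ< _ ⟩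
    suc (toℕ (fromℕ m)) % suc m ≡⟨ ≡.cong (λ x → suc x % suc m) (toℕ-fromℕ m) ⟩
    suc m % suc m               ≡⟨ n%n≡0 (suc m) ⟩
    0                           ∎)

  next-cases : ∀ {m} (i : Fin (suc m)) → toℕ (next i) ≡ suc (toℕ i) ⊎ i ≡ fromℕ m
  next-cases {m} i with toℕ i ℕ.≟ m
  ... | yes i≡m = inj₂ (toℕ-injective (≡.trans i≡m (≡.sym (toℕ-fromℕ m))))
  ... | no  i≢m = inj₁ (toℕ-next-< (ℕ.≤∧≢⇒< (ℕ.s≤s⁻¹ (toℕ<n i)) i≢m))

  next-injective : ∀ {m} {i j : Fin (suc m)} → next i ≡ next j → i ≡ j
  next-injective {m} {i} {j} eq with next-cases i | next-cases j
  ... | inj₁ ni     | inj₁ nj     =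
    toℕ-injective (ℕ.suc-injective (≡.trans (≡.sym ni) (≡.trans (≡.cong toℕ eq) nj)))
  ... | inj₂ i≡m    | inj₂ j≡m    = ≡.trans i≡m (≡.sym j≡m)
  ... | inj₁ ni     | inj₂ ≡.refl
    with () ← ≡.trans (≡.sym ni) (≡.trans (≡.cong toℕ eq) (≡.cong toℕ (next-fromℕ m)))
  ... | inj₂ ≡.refl | inj₁ nj
    with () ← ≡.trans (≡.sym nj) (≡.trans (≡.cong toℕ (≡.sym eq)) (≡.cong toℕ (next-fromℕ m)))

module CycleMatchings where
  open CycleIndexing

  isEven : ℕ → Bool
  isEven zero    = true
  isEven (suc n) = not (isEven n)

  isEven-double : ∀ k → isEven (double k) ≡ true
  isEven-double zero    = ≡.refl
  isEven-double (suc k) = ≡.trans (not-involutive _) (isEven-double k)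

  isEven-next : ∀ k (i : Fin (double (suc k))) → isEven (toℕ (next i)) ≡ not (isEven (toℕ i))
  isEven-next k i with next-cases i
  ... | inj₁ next≡1+i = ≡.cong isEven next≡1+i
  ... | inj₂ ≡.refl rewrite next-fromℕ (suc (double k)) | toℕ-fromℕ (double k) | isEven-double k = ≡.refl

  ∈-alternating⇒isEven : ∀ {n} b {i : Fin n} → i ∈ alternating b n → isEven (toℕ i) ≡ b
  ∈-alternating⇒isEven b here       = ≡.refl
  ∈-alternating⇒isEven b (there i∈) =
    ≡.trans (≡.cong not (∈-alternating⇒isEven (not b) i∈)) (not-involutive b)

  ∣alternating∣ : ∀ b k → ∣ alternating b (double k) ∣ ≡ k
  ∣alternating∣ b     zero    = ≡.refl
  ∣alternating∣ true  (suc k) = ≡.cong suc (∣alternating∣ true k)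
  ∣alternating∣ false (suc k) = ≡.cong suc (∣alternating∣ false k)

  fromℕ∈alternating : ∀ k → fromℕ (double k) ∈ alternating inside (suc (double k))
  fromℕ∈alternating zero    = here
  fromℕ∈alternating (suc k) = there (there (fromℕ∈alternating k))

  ∈?-alternating-inject₁ : ∀ b {m} (r : Fin m) →
                           does (inject₁ r ∈? alternating b (suc m)) ≡ does (r ∈? alternating b m)
  ∈?-alternating-inject₁ true  zero    = ≡.refl
  ∈?-alternating-inject₁ false zero    = ≡.refl
  ∈?-alternating-inject₁ b     (suc r) = ∈?-alternating-inject₁ (not b) r

  alternating-isMatching : ∀ b k → IsMatching (suc k) (alternating b (double (suc k)))
  alternating-isMatching b k = ∣alternating∣ b (suc k) , disjoint
    where
    parity : ∀ {i} → i ∈ alternating b (double (suc k)) → isEven (toℕ i) ≡ b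
    parity = ∈-alternating⇒isEven b
    not-next : ∀ {i j} → i ∈ alternating b _ → j ∈ alternating b _ → i ≢ next j
    not-next {i} {j} i∈ j∈ ≡.refl =
      not-¬ ≡.refl (≡.trans (≡.sym (parity i∈)) (≡.trans (isEven-next k j) (≡.cong not (parity j∈))))
    disjoint : ∀ i j → i ∈ alternating b _ → j ∈ alternating b _ → i ≢ j → Disjoint i j
    disjoint i j i∈ j∈ i≢j =
      i≢j , not-next i∈ j∈ , (λ next≡ → not-next j∈ i∈ (≡.sym next≡)) , i≢j ∘ next-injective

  NoTwoConsecutive : ∀ {n} → Subset n → Set
  NoTwoConsecutive S = ∀ i j → toℕ j ≡ suc (toℕ i) → i ∈ S → j ∈ S → ⊥

  noTwoConsecutive-tail : ∀ {n x} {S : Subset n} → NoTwoConsecutive (x ∷ S) → NoTwoConsecutive S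
  noTwoConsecutive-tail noTwo i j j≡1+i i∈ j∈ =
    noTwo (suc i) (suc j) (≡.cong suc j≡1+i) (there i∈) (there j∈)

  noTwoConsecutive-tail₂ : ∀ {n x y} {S : Subset n} → NoTwoConsecutive (x ∷ y ∷ S) → NoTwoConsecutive S
  noTwoConsecutive-tail₂ = noTwoConsecutive-tail ∘ noTwoConsecutive-tail

  ¬noTwoConsecutive-inside² : ∀ {n} {S : Subset n} → ¬ NoTwoConsecutive (inside ∷ inside ∷ S)
  ¬noTwoConsecutive-inside² noTwo = noTwo zero (suc zero) ≡.refl here (there here)

  double∣∣≤ : ∀ {n} (S : Subset n) → NoTwoConsecutive S → double ∣ S ∣ ℕ.≤ suc n
  double∣∣≤ []                     _     = ℕ.z≤n
  double∣∣≤ (outside ∷ S)          noTwo = ℕ.m≤n⇒m≤1+n (double∣∣≤ S (noTwoConsecutive-tail noTwo))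
  double∣∣≤ (inside ∷ [])          _     = ℕ.≤-refl
  double∣∣≤ (inside ∷ inside ∷ S)  noTwo = ⊥-elim (¬noTwoConsecutive-inside² noTwo)
  double∣∣≤ (inside ∷ outside ∷ S) noTwo = s<s (s<s (double∣∣≤ S (noTwoConsecutive-tail₂ noTwo)))

  double∣∣≡⇒alternating : ∀ {n} (S : Subset n) → NoTwoConsecutive S → double ∣ S ∣ ≡ suc n →
                          S ≡ alternating inside n
  double∣∣≡⇒alternating []                     _     ()
  double∣∣≡⇒alternating (outside ∷ S)          noTwo eq =
    ⊥-elim (ℕ.<-irrefl eq (s<s (double∣∣≤ S (noTwoConsecutive-tail noTwo))))
  double∣∣≡⇒alternating (inside ∷ [])          _     _  = ≡.refl
  double∣∣≡⇒alternating (inside ∷ inside ∷ S)  noTwo _  = ⊥-elim (¬noTwoConsecutive-inside² noTwo)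
  double∣∣≡⇒alternating (inside ∷ outside ∷ S) noTwo eq = ≡.cong (λ T → inside ∷ outside ∷ T)
    (double∣∣≡⇒alternating S (noTwoConsecutive-tail₂ noTwo) (ℕ.suc-injective (ℕ.suc-injective eq)))

  lastOutside⇒alternating : ∀ k (S : Subset (double k)) → NoTwoConsecutive S → ∣ S ∣ ≡ k →
                            (∀ i → suc (toℕ i) ≡ double k → i ∈ S → ⊥) → S ≡ alternating inside (double k)
  lastOutside⇒alternating zero    []                     _     _    _       = ≡.refl
  lastOutside⇒alternating (suc k) (inside ∷ inside ∷ S)  noTwo _    _       =
    ⊥-elim (¬noTwoConsecutive-inside² noTwo)
  lastOutside⇒alternating (suc k) (inside ∷ outside ∷ S) noTwo ∣S∣≡ lastOut =
    ≡.cong (λ T → inside ∷ outside ∷ T) (lastOutside⇒alternating k S (noTwoConsecutive-tail₂ noTwo) (ℕ.suc-injective ∣S∣≡)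
      λ i i≡last i∈ → lastOut (suc (suc i)) (≡.cong (λ m → suc (suc m)) i≡last) (there (there i∈)))
  lastOutside⇒alternating (suc k) (outside ∷ S)          noTwo ∣S∣≡ lastOut
    with ≡.refl ← double∣∣≡⇒alternating S (noTwoConsecutive-tail noTwo) (≡.cong double ∣S∣≡) =
    ⊥-elim (lastOut (suc (fromℕ (double k))) (≡.cong (λ m → suc (suc m)) (toℕ-fromℕ (double k)))
                    (there (fromℕ∈alternating k)))

  disjoint⇒next≢ : ∀ {n} {i j : Fin n} → Disjoint i j → next i ≢ j
  disjoint⇒next≢ = proj₁ ∘ proj₂ ∘ proj₂

  isMatching⇒alternating : ∀ k (S : Subset (double (suc k))) → IsMatching (suc k) S →
                           S ≡ alternating inside (double (suc k)) ⊎ S ≡ alternating outside (double (suc k))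
  isMatching⇒alternating k S (∣S∣≡ , disjoint) = classify S noTwo wrap ∣S∣≡
    where
    last = fromℕ (suc (double k))
    noTwo : NoTwoConsecutive S
    noTwo i j j≡1+i i∈ j∈ = disjoint⇒next≢ (disjoint i j i∈ j∈ i≢j) (next-suc j≡1+i)
      where i≢j = λ i≡j → ℕ.1+n≢n (≡.trans (≡.sym j≡1+i) (≡.cong toℕ (≡.sym i≡j)))
    wrap : zero ∈ S → last ∈ S → ⊥
    wrap 0∈ last∈ = disjoint⇒next≢ (disjoint last zero last∈ 0∈ λ ()) (next-fromℕ (suc (double k)))
    classify : ∀ (S : Subset (double (suc k))) → NoTwoConsecutive S → (zero ∈ S → last ∈ S → ⊥) →
               ∣ S ∣ ≡ suc k → S ≡ alternating inside _ ⊎ S ≡ alternating outside _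
    classify (outside ∷ S)          noTwo _    ∣S∣≡ =
      inj₂ (≡.cong (outside ∷_)
                   (double∣∣≡⇒alternating S (noTwoConsecutive-tail noTwo) (≡.cong double ∣S∣≡)))
    classify (inside ∷ inside ∷ S)  noTwo _    _    = ⊥-elim (¬noTwoConsecutive-inside² noTwo)
    classify (inside ∷ outside ∷ S) noTwo wrap ∣S∣≡ = inj₁ (≡.cong (λ T → inside ∷ outside ∷ T)
      (lastOutside⇒alternating k S (noTwoConsecutive-tail₂ noTwo) (ℕ.suc-injective ∣S∣≡) lastOut))
      where
      lastOut : ∀ i → suc (toℕ i) ≡ double k → i ∈ S → ⊥
      lastOut i i≡last i∈ =
        wrap here (≡.subst (_∈ (inside ∷ outside ∷ S)) (toℕ-injective toℕ≡) (there (there i∈)))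
        where toℕ≡ = ≡.trans (≡.cong suc i≡last) (≡.sym (toℕ-fromℕ (suc (double k))))

_≟ₛ_ : ∀ {n} → DecidableEquality (Subset n)
_≟ₛ_ = ≡-dec Bool._≟_

module MatchingSums {c ℓ} (R : CommutativeRing c ℓ) where
  open CommutativeRing R hiding (zero)
  open FiniteSums R
  open CycleMatchings
  open import Relation.Binary.Reasoning.Setoid setoid
  open import Algebra.Properties.CommutativeSemigroup +-commutativeSemigroup using (interchange)

  sumL-++ : ∀ xs ys → sumL R (xs List.++ ys) ≈ sumL R xs + sumL R ys
  sumL-++ []       ys = sym (+-identityˡ _)
  sumL-++ (x ∷ xs) ys = trans (+-congˡ (sumL-++ xs ys)) (sym (+-assoc _ _ _))

  sumL-map-cong : ∀ {a} {A : Set a} {g h : A → Carrier} → (∀ x → g x ≈ h x) → ∀ xs →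
                  sumL R (List.map g xs) ≈ sumL R (List.map h xs)
  sumL-map-cong g≈h []       = refl
  sumL-map-cong g≈h (x ∷ xs) = +-cong (g≈h x) (sumL-map-cong g≈h xs)

  sumL-map-zero : ∀ {a} {A : Set a} {g : A → Carrier} → (∀ x → g x ≈ 0#) → ∀ xs →
                  sumL R (List.map g xs) ≈ 0#
  sumL-map-zero g≈0 []       = refl
  sumL-map-zero g≈0 (x ∷ xs) = trans (+-cong (g≈0 x) (sumL-map-zero g≈0 xs)) (+-identityˡ 0#)

  sumL-map-+ : ∀ {a} {A : Set a} (g h : A → Carrier) xs →
               sumL R (List.map (λ x → g x + h x) xs) ≈ sumL R (List.map g xs) + sumL R (List.map h xs)
  sumL-map-+ g h []       = sym (+-identityˡ 0#)
  sumL-map-+ g h (x ∷ xs) = trans (+-congˡ (sumL-map-+ g h xs)) (interchange (g x) (h x) _ _)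

  sumL-map-filter : ∀ {a p} {A : Set a} {P : Pred A p} (P? : Decidable P) (h : A → Carrier) xs →
                    sumL R (List.map h (filter P? xs)) ≈
                    sumL R (List.map (λ x → if does (P? x) then h x else 0#) xs)
  sumL-map-filter P? h []       = refl
  sumL-map-filter P? h (x ∷ xs) with does (P? x)
  ... | true  = +-congˡ (sumL-map-filter P? h xs)
  ... | false = trans (sumL-map-filter P? h xs) (sym (+-identityˡ _))

  sumL-indicator : ∀ n (T : Subset n) x →
                   sumL R (List.map (λ S → if does (S ≟ₛ T) then x else 0#) (allSubsets n)) ≈ x
  sumL-indicator zero    []      x = +-identityʳ x
  sumL-indicator (suc n) (b ∷ T) x = begin
    sumL R (List.map δ (List.map (inside ∷_) Ss List.++ List.map (outside ∷_) Ss))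
      ≡⟨ ≡.cong (sumL R) (List.map-++ δ (List.map (inside ∷_) Ss) _) ⟩
    sumL R (List.map δ (List.map (inside ∷_) Ss) List.++ List.map δ (List.map (outside ∷_) Ss))
      ≈⟨ sumL-++ (List.map δ (List.map (inside ∷_) Ss)) _ ⟩
    sumL R (List.map δ (List.map (inside ∷_) Ss)) + sumL R (List.map δ (List.map (outside ∷_) Ss))
      ≡⟨ ≡.cong₂ (λ xs ys → sumL R xs + sumL R ys) (List.map-∘ Ss) (List.map-∘ Ss) ⟨
    sumL R (List.map (δ ∘ (inside ∷_)) Ss) + sumL R (List.map (δ ∘ (outside ∷_)) Ss)
      ≈⟨ split b ⟩
    x ∎
    where
    Ss = allSubsets n
    δ : Subset (suc n) → Carrier
    δ S = if does (S ≟ₛ (b ∷ T)) then x else 0#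
    split : ∀ b → sumL R (List.map (λ S → if does ((inside ∷ S) ≟ₛ (b ∷ T)) then x else 0#) Ss)
                  + sumL R (List.map (λ S → if does ((outside ∷ S) ≟ₛ (b ∷ T)) then x else 0#) Ss) ≈ x
    split true  = trans (+-cong (sumL-indicator n T x) (sumL-map-zero (λ _ → refl) Ss)) (+-identityʳ x)
    split false = trans (+-cong (sumL-map-zero (λ _ → refl) Ss) (sumL-indicator n T x)) (+-identityˡ x)

  sumL-matchings-cycle : ∀ k (h : Subset (double (suc k)) → Carrier) →
    sumL R (List.map h (matchings (double (suc k)) (suc k))) ≈
    h (alternating inside (double (suc k))) + h (alternating outside (double (suc k)))
  sumL-matchings-cycle k h = begin
    sumL R (List.map h (filter (isMatching? (suc k)) Ss))
      ≈⟨ sumL-map-filter (isMatching? (suc k)) h Ss ⟩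
    sumL R (List.map (λ S → if does (isMatching? (suc k) S) then h S else 0#) Ss)
      ≈⟨ sumL-map-cong (λ S → indicator (isMatching? (suc k) S) (S ≟ₛ E) (S ≟ₛ O)) Ss ⟩
    sumL R (List.map (λ S → δ E S + δ O S) Ss)
      ≈⟨ sumL-map-+ (δ E) (δ O) Ss ⟩
    sumL R (List.map (δ E) Ss) + sumL R (List.map (δ O) Ss)
      ≈⟨ +-cong (sumL-indicator n E (h E)) (sumL-indicator n O (h O)) ⟩
    h E + h O ∎
    where
    n = double (suc k)
    Ss = allSubsets n
    E = alternating inside n
    O = alternating outside n
    δ : Subset n → Subset n → Carrier
    δ T S = if does (S ≟ₛ T) then h T else 0#
    indicator : ∀ {S} (m? : Dec (IsMatching (suc k) S)) (e? : Dec (S ≡ E)) (o? : Dec (S ≡ O)) →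
      (if does m? then h S else 0#) ≈ (if does e? then h E else 0#) + (if does o? then h O else 0#)
    indicator (yes _)  (yes ≡.refl) (no _)       = sym (+-identityʳ _)
    indicator (yes _)  (no _)       (yes ≡.refl) = sym (+-identityˡ _)
    indicator (yes _)  (yes ≡.refl) (yes ())
    indicator (yes m)  (no S≢E)     (no S≢O)     = ⊥-elim ([ S≢E , S≢O ] (isMatching⇒alternating k _ m))
    indicator (no ¬m)  (yes ≡.refl) _            = ⊥-elim (¬m (alternating-isMatching inside k))
    indicator (no ¬m)  (no _)       (yes ≡.refl) = ⊥-elim (¬m (alternating-isMatching outside k))
    indicator (no _)   (no _)       (no _)       = sym (+-identityˡ 0#)

  productOver-alternating-outside : ∀ k (w : Fin (double (suc (suc k))) → Carrier) →
    productOver (alternating outside (double (suc (suc k)))) w ≈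
    productOver (alternating inside (double (suc k))) (λ r → w (suc (inject₁ r))) * w (fromℕ (suc (double (suc k))))
  productOver-alternating-outside k w = begin
    1# * prodF R v                               ≈⟨ *-identityˡ _ ⟩
    prodF R v                                    ≈⟨ prodF-init-last v ⟩
    prodF R (λ r → v (inject₁ r)) * v (fromℕ m)
      ≈⟨ *-cong (prodF-cong (reflexive ∘ init≡)) (reflexive last≡) ⟩
    productOver (alternating inside m) (λ r → w (suc (inject₁ r))) * w (suc (fromℕ m)) ∎
    where
    m = double (suc k)
    v : Fin (suc m) → Carrier
    v i = if does (i ∈? alternating inside (suc m)) then w (suc i) else 1#
    init≡ : ∀ r → v (inject₁ r) ≡ (if does (r ∈? alternating inside m) then w (suc (inject₁ r)) else 1#)
    init≡ r = ≡.cong (λ b → if b then w (suc (inject₁ r)) else 1#) (∈?-alternating-inject₁ inside r)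
    last≡ : v (fromℕ m) ≡ w (suc (fromℕ m))
    last≡ = ≡.cong (λ b → if b then w (suc (fromℕ m)) else 1#)
                   (dec-true (fromℕ m ∈? _) (fromℕ∈alternating (suc k)))

module AntiInvolution {c ℓ} (R : CommutativeRing c ℓ) (isField : IsField R)
                      (f : CommutativeRing.Carrier R → CommutativeRing.Carrier R) (anti : IsAntiInvolution R f) where
  open CommutativeRing R hiding (zero)
  open import Relation.Binary.Reasoning.Setoid setoid

  private
    f-cong : ∀ {x y} → ¬ x ≈ 0# → x ≈ y → f x ≈ f y
    f-cong = proj₁ anti _ _

    f-* : ∀ {x y} → ¬ x ≈ 0# → ¬ y ≈ 0# → f (x * y) ≈ f y * f x
    f-* = proj₂ (proj₂ (proj₂ anti)) _ _

  *-nonzero : ∀ {x y} → ¬ x ≈ 0# → ¬ y ≈ 0# → ¬ x * y ≈ 0#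
  *-nonzero {x} {y} x≉0 y≉0 xy≈0 with proj₂ isField x x≉0
  ... | x⁻¹ , xx⁻¹≈1 = y≉0 (begin
    y               ≈⟨ *-identityˡ y ⟨
    1# * y          ≈⟨ *-congʳ xx⁻¹≈1 ⟨
    x * x⁻¹ * y     ≈⟨ *-congʳ (*-comm x x⁻¹) ⟩
    x⁻¹ * x * y     ≈⟨ *-assoc x⁻¹ x y ⟩
    x⁻¹ * (x * y)   ≈⟨ *-congˡ xy≈0 ⟩
    x⁻¹ * 0#        ≈⟨ zeroʳ x⁻¹ ⟩
    0#              ∎)

  prodF-nonzero : ∀ {n} (v : Fin n → Carrier) → (∀ i → ¬ v i ≈ 0#) → ¬ prodF R v ≈ 0#
  prodF-nonzero {zero}  v _   = proj₁ isField
  prodF-nonzero {suc n} v v≉0 = *-nonzero (v≉0 zero) (prodF-nonzero (λ i → v (suc i)) (λ i → v≉0 (suc i)))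

  f-prodF : ∀ {n} (v : Fin (suc n) → Carrier) → (∀ i → ¬ v i ≈ 0#) →
            f (prodF R v) ≈ prodF R (λ i → f (v i))
  f-prodF {zero}  v v≉0 = begin
    f (v zero * 1#)  ≈⟨ f-cong (*-nonzero (v≉0 zero) (proj₁ isField)) (*-identityʳ (v zero)) ⟩
    f (v zero)       ≈⟨ *-identityʳ (f (v zero)) ⟨
    f (v zero) * 1#  ∎
  f-prodF {suc n} v v≉0 = begin
    f (v zero * prodF R w)                ≈⟨ f-* (v≉0 zero) (prodF-nonzero w (λ i → v≉0 (suc i))) ⟩
    f (prodF R w) * f (v zero)            ≈⟨ *-congʳ (f-prodF w (λ i → v≉0 (suc i))) ⟩
    prodF R (λ i → f (w i)) * f (v zero)  ≈⟨ *-comm _ _ ⟩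
    f (v zero) * prodF R (λ i → f (w i))  ∎
    where w = λ i → v (suc i)

module CycleMatrix {c ℓ} (R : CommutativeRing c ℓ) {t : ℕ}
                   (φ : Fin (suc (suc (suc t))) → Fin (suc (suc (suc t))) → CommutativeRing.Carrier R) where
  open CommutativeRing R hiding (zero)
  open Determinant R
  open AdjacencyMatrix R
  open PathMatrix R
  open CycleIndexing
  open import Relation.Binary.Reasoning.Setoid setoid

  L : ℕ
  L = suc (suc t)

  last : Fin (suc L)
  last = fromℕ L

  CornerAdj : Fin (suc L) → Fin (suc L) → Set
  CornerAdj i j = (i ≡ zero × j ≡ last) ⊎ (i ≡ last × j ≡ zero)

  cornerAdj? : ∀ i j → Dec (CornerAdj i j)
  cornerAdj? i j = ((i Fin.≟ zero) ×-dec (j Fin.≟ last)) ⊎-dec ((i Fin.≟ last) ×-dec (j Fin.≟ zero))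

  A P E : Matrix (suc L)
  A = adjMatrix R cycleAdj? φ
  P = pathMatrix φ
  E = adjMatrix R cornerAdj? φ

  cycleAdj⇒ : ∀ {i j} → CycleAdj i j → PathAdj i j ⊎ CornerAdj i j
  cycleAdj⇒ {i} {j} (inj₁ j≡next-i) with next-cases i
  ... | inj₁ next-i≡1+i = inj₁ (inj₁ (≡.trans (≡.cong toℕ j≡next-i) next-i≡1+i))
  ... | inj₂ ≡.refl     = inj₂ (inj₂ (≡.refl , ≡.trans j≡next-i (next-fromℕ L)))
  cycleAdj⇒ {i} {j} (inj₂ i≡next-j) with next-cases j
  ... | inj₁ next-j≡1+j = inj₁ (inj₂ (≡.trans (≡.cong toℕ i≡next-j) next-j≡1+j))
  ... | inj₂ ≡.refl     = inj₂ (inj₁ (≡.trans i≡next-j (next-fromℕ L) , ≡.refl))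

  ⇒cycleAdj : ∀ {i j} → PathAdj i j ⊎ CornerAdj i j → CycleAdj i j
  ⇒cycleAdj (inj₁ (inj₁ j≡1+i))            = inj₁ (≡.sym (next-suc j≡1+i))
  ⇒cycleAdj (inj₁ (inj₂ i≡1+j))            = inj₂ (≡.sym (next-suc i≡1+j))
  ⇒cycleAdj (inj₂ (inj₁ (≡.refl , ≡.refl))) = inj₂ (≡.sym (next-fromℕ L))
  ⇒cycleAdj (inj₂ (inj₂ (≡.refl , ≡.refl))) = inj₁ (≡.sym (next-fromℕ L))

  path-corner-disjoint : ∀ {i j} → PathAdj i j → ¬ CornerAdj i j
  path-corner-disjoint (inj₁ ()) (inj₁ (≡.refl , ≡.refl))
  path-corner-disjoint (inj₂ ()) (inj₁ (≡.refl , ≡.refl))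
  path-corner-disjoint (inj₁ ()) (inj₂ (≡.refl , ≡.refl))
  path-corner-disjoint (inj₂ ()) (inj₂ (≡.refl , ≡.refl))

  A≈P+E : ∀ i j → A i j ≈ P i j + E i j
  A≈P+E i j = adjMatrix-⊎ cycleAdj? φ pathAdj? cornerAdj? cycleAdj⇒ ⇒cycleAdj path-corner-disjoint

  E-first : ∀ {j} → j ≢ last → E zero j ≡ 0#
  E-first j≢last = adjMatrix-nonadj cornerAdj? φ λ where
    (inj₁ (_ , j≡last)) → j≢last j≡last
    (inj₂ (() , _))

  E-last : ∀ {j} → j ≢ zero → E last j ≡ 0#
  E-last j≢0 = adjMatrix-nonadj cornerAdj? φ λ where
    (inj₁ (() , _))
    (inj₂ (_ , j≡0)) → j≢0 j≡0

  E-inner : ∀ {i j} → i ≢ zero → i ≢ last → E i j ≡ 0#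
  E-inner i≢0 i≢last = adjMatrix-nonadj cornerAdj? φ λ where
    (inj₁ (i≡0 , _))    → i≢0 i≡0
    (inj₂ (i≡last , _)) → i≢last i≡last

  c₁ c₂ : Carrier
  c₁ = φ zero last
  c₂ = φ last zero

  E-c₁ : E zero last ≡ c₁
  E-c₁ = adjMatrix-adj cornerAdj? φ (inj₁ (≡.refl , ≡.refl))

  E-c₂ : E last zero ≡ c₂
  E-c₂ = adjMatrix-adj cornerAdj? φ (inj₂ (≡.refl , ≡.refl))

  pathGain reversePathGain : Carrier
  pathGain        = prodF R (λ r → φ (inject₁ r) (suc r))
  reversePathGain = prodF R (λ r → φ (suc r) (inject₁ r))

  inner : Matrix (suc t)
  inner r s = φ (suc (inject₁ r)) (suc (inject₁ s))

  withEndRows : (Fin (suc L) → Carrier) → (Fin (suc L) → Carrier) → Matrix (suc L)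
  withEndRows first last′ = setRow last last′ (setRow zero first P)

  withEndRows-first : ∀ first last′ j → withEndRows first last′ zero j ≡ first j
  withEndRows-first first last′ j = setRow-off {p = last} {i = zero} last′ (setRow zero first P) j λ ()

  withEndRows-last : ∀ first last′ j → withEndRows first last′ last j ≡ last′ j
  withEndRows-last first last′ j = setRow-at last last′ (setRow zero first P) j

  withEndRows-inner : ∀ first last′ {i} j → i ≢ zero → i ≢ last → withEndRows first last′ i j ≡ P i j
  withEndRows-inner first last′ {zero}  j i≢0 _      = ⊥-elim (i≢0 ≡.refl)
  withEndRows-inner first last′ {suc i} j _   i≢last = setRow-off last′ (setRow zero first P) j i≢last

  withEndRows-pathFirst : ∀ last′ {i} j → i ≢ last → withEndRows (P zero) last′ i j ≡ P i j
  withEndRows-pathFirst last′ {zero}  j _      = withEndRows-first (P zero) last′ j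
  withEndRows-pathFirst last′ {suc i} j i≢last = withEndRows-inner (P zero) last′ j (λ ()) i≢last

  withEndRows-pathLast : ∀ first {i} j → i ≢ zero → withEndRows first (P last) i j ≡ P i j
  withEndRows-pathLast first {i} j i≢0 = by-row (i Fin.≟ last)
    where
    by-row : Dec (i ≡ last) → withEndRows first (P last) i j ≡ P i j
    by-row (yes ≡.refl)  = withEndRows-last first (P last) j
    by-row (no  i≢last) = withEndRows-inner first (P last) j i≢0 i≢last

  det-cycleMatrix-split :
    det R A ≈ (det R (withEndRows (P zero) (P last)) + det R (withEndRows (P zero) (E last)))
            + (det R (withEndRows (E zero) (P last)) + det R (withEndRows (E zero) (E last)))
  det-cycleMatrix-split = begin
    det R A
      ≈⟨ det-cong A≈rows ⟩
    det R (setRow zero (λ j → P zero j + E zero j) Y)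
      ≈⟨ det-setRow-+ zero (P zero) (E zero) Y ⟩
    det R (setRow zero (P zero) Y) + det R (setRow zero (E zero) Y)
      ≈⟨ +-cong (split-last (P zero)) (split-last (E zero)) ⟩
    _ ∎
    where
    lastRow = λ j → P last j + E last j
    Y = setRow last lastRow P
    A≈rows : ∀ i j → A i j ≈ setRow zero (λ j → P zero j + E zero j) Y i j
    A≈rows zero    j = A≈P+E zero j
    A≈rows (suc i) j with suc i Fin.≟ last
    ... | yes ≡.refl  = trans (A≈P+E last j) (reflexive (≡.sym (setRow-at last lastRow P j)))
    ... | no  i≢last = begin
      A (suc i) j                ≈⟨ A≈P+E (suc i) j ⟩
      P (suc i) j + E (suc i) j  ≡⟨ ≡.cong (P (suc i) j +_) (E-inner (λ ()) i≢last) ⟩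
      P (suc i) j + 0#           ≈⟨ +-identityʳ _ ⟩
      P (suc i) j                ≡⟨ setRow-off lastRow P j i≢last ⟨
      Y (suc i) j                ∎
    split-last : ∀ first → det R (setRow zero first Y) ≈
                           det R (withEndRows first (P last)) + det R (withEndRows first (E last))
    split-last first =
      trans (det-cong λ i j → reflexive (setRow-comm {p = zero} {q = last} (λ ()) first lastRow P i j))
            (det-setRow-+ last (P last) (E last) (setRow zero first P))

  det-withEndRows-path : det R (withEndRows (P zero) (P last)) ≈ det R P
  det-withEndRows-path = det-cong {M = withEndRows (P zero) (P last)} {N = P} λ where
    zero    j → reflexive (withEndRows-first (P zero) (P last) j)
    (suc i) j → reflexive (withEndRows-pathLast (P zero) j λ ())

  det-withEndRows-lastCorner : det R (withEndRows (P zero) (E last)) ≈ signF R L * (c₂ * pathGain)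
  det-withEndRows-lastCorner = begin
    det R M  ≈⟨ det-expand-lastRow M last-row ⟩
    signF R L * (M last zero * det R (λ r s → M (inject₁ r) (suc s)))
      ≈⟨ *-congˡ (*-cong (reflexive (≡.trans (withEndRows-last (P zero) (E last) zero) E-c₂))
                         (det-cong λ r s → reflexive (withEndRows-pathFirst (E last) (suc s) (inject₁≢fromℕ r)))) ⟩
    signF R L * (c₂ * det R (λ r s → P (inject₁ r) (suc s)))
      ≈⟨ *-congˡ (*-congˡ (det-pathMatrix-superdiagonal φ)) ⟩
    signF R L * (c₂ * pathGain) ∎
    where
    M = withEndRows (P zero) (E last)
    last-row : ∀ j → j ≢ zero → M last j ≈ 0#
    last-row j j≢0 = reflexive (≡.trans (withEndRows-last (P zero) (E last) j) (E-last j≢0))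

  det-withEndRows-firstCorner : det R (withEndRows (E zero) (P last)) ≈ signF R L * (c₁ * reversePathGain)
  det-withEndRows-firstCorner = begin
    det R M  ≈⟨ det-expand-firstRow M last first-row ⟩
    signF R (toℕ last) * (M zero last * det R (minor M last))
      ≈⟨ *-cong (reflexive (≡.cong (signF R) (toℕ-fromℕ L)))
                (*-cong (reflexive (≡.trans (withEndRows-first (E zero) (P last) last) E-c₁))
                        (det-cong λ r s → reflexive (≡.trans (withEndRows-pathLast (E zero) _ λ ())
                                                             (≡.cong (P (suc r)) (punchIn-fromℕ s))))) ⟩
    signF R L * (c₁ * det R (λ r s → P (suc r) (inject₁ s)))
      ≈⟨ *-congˡ (*-congˡ (det-pathMatrix-subdiagonal φ)) ⟩
    signF R L * (c₁ * reversePathGain) ∎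
    where
    M = withEndRows (E zero) (P last)
    first-row : ∀ j → j ≢ last → M zero j ≈ 0#
    first-row j j≢last = reflexive (≡.trans (withEndRows-first (E zero) (P last) j) (E-first j≢last))

  det-withEndRows-corners :
    det R (withEndRows (E zero) (E last)) ≈ signF R L * (c₁ * (signF R (suc t) * (c₂ * det R (pathMatrix inner))))
  det-withEndRows-corners = begin
    det R M  ≈⟨ det-expand-firstRow M last first-row ⟩
    signF R (toℕ last) * (M zero last * det R N)
      ≈⟨ *-cong (reflexive (≡.cong (signF R) (toℕ-fromℕ L)))
                (*-cong (reflexive (≡.trans (withEndRows-first (E zero) (E last) last) E-c₁))
                        (det-expand-lastRow N N-last-row)) ⟩
    signF R L * (c₁ * (signF R (suc t) * (N (fromℕ (suc t)) zero * det R (λ r s → N (inject₁ r) (suc s)))))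
      ≈⟨ *-congˡ (*-congˡ (*-congˡ (*-cong (reflexive (≡.trans (withEndRows-last (E zero) (E last) zero) E-c₂))
                                          (det-cong λ r s → reflexive (N-inner r s))))) ⟩
    signF R L * (c₁ * (signF R (suc t) * (c₂ * det R (pathMatrix inner)))) ∎
    where
    M = withEndRows (E zero) (E last)
    N = minor M last
    first-row : ∀ j → j ≢ last → M zero j ≈ 0#
    first-row j j≢last = reflexive (≡.trans (withEndRows-first (E zero) (E last) j) (E-first j≢last))
    N-last-row : ∀ s → s ≢ zero → N (fromℕ (suc t)) s ≈ 0#
    N-last-row zero    0≢0 = ⊥-elim (0≢0 ≡.refl)
    N-last-row (suc s) _   = reflexive (≡.trans (withEndRows-last (E zero) (E last) _) (E-last λ ()))
    N-inner : ∀ r s → N (inject₁ r) (suc s) ≡ pathMatrix inner r s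
    N-inner r s = ≡.trans (withEndRows-inner (E zero) (E last) _ (λ ()) (inject₁≢fromℕ r ∘ suc-injective))
                 (≡.trans (≡.cong (P (suc (inject₁ r))) (punchIn-fromℕ (suc s)))
                          (pathMatrix-shift (suc ∘ inject₁) (λ i → ≡.cong suc (toℕ-inject₁ i)) φ r s))

  det-cycleMatrix : det R A ≈ (det R P + signF R L * (c₂ * pathGain))
                            + (signF R L * (c₁ * reversePathGain)
                               + signF R L * (c₁ * (signF R (suc t) * (c₂ * det R (pathMatrix inner)))))
  det-cycleMatrix = trans det-cycleMatrix-split (+-cong (+-cong det-withEndRows-path det-withEndRows-lastCorner)
                                                        (+-cong det-withEndRows-firstCorner det-withEndRows-corners))

module SkewGainCycle {c ℓ} (R : CommutativeRing c ℓ) (isField : IsField R)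
                     (f : CommutativeRing.Carrier R → CommutativeRing.Carrier R) (anti : IsAntiInvolution R f)
                     {t : ℕ} (φ : Fin (suc (suc (suc t))) → Fin (suc (suc (suc t))) → CommutativeRing.Carrier R)
                     (skew : IsSkewGain R f CycleAdj φ) where
  open CommutativeRing R hiding (zero)
  open FiniteSums R
  open CycleIndexing
  open CycleMatrix R φ
  open AntiInvolution R isField f anti
  open import Relation.Binary.Reasoning.Setoid setoid

  next-inject₁ : ∀ (r : Fin L) → next (inject₁ r) ≡ suc r
  next-inject₁ r = next-suc (≡.cong suc (≡.sym (toℕ-inject₁ r)))

  cycleGain-split : cycleGain R φ ≈ pathGain * c₂
  cycleGain-split = trans (prodF-init-last (λ i → φ i (next i)))
                          (*-cong (prodF-cong λ r → reflexive (≡.cong (φ (inject₁ r)) (next-inject₁ r)))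
                                  (reflexive (≡.cong (φ last) (next-fromℕ L))))

  f-cycleGain-split : f (cycleGain R φ) ≈ reversePathGain * c₁
  f-cycleGain-split = begin
    f (prodF R (λ i → φ i (next i)))  ≈⟨ f-prodF _ (λ i → proj₁ skew i (next i) (inj₁ ≡.refl)) ⟩
    prodF R (λ i → f (φ i (next i)))  ≈⟨ prodF-cong (λ i → sym (proj₂ skew i (next i) (inj₁ ≡.refl))) ⟩
    prodF R (λ i → φ (next i) i)      ≈⟨ prodF-init-last (λ i → φ (next i) i) ⟩
    prodF R (λ r → φ (next (inject₁ r)) (inject₁ r)) * φ (next last) last
      ≈⟨ *-cong (prodF-cong λ r → reflexive (≡.cong (λ j → φ j (inject₁ r)) (next-inject₁ r)))
                (reflexive (≡.cong (λ j → φ j last) (next-fromℕ L))) ⟩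
    reversePathGain * c₁              ∎

  edgeWeight : Fin (suc L) → Carrier
  edgeWeight i = φ i (next i) * f (φ i (next i))

  edgeWeight-suc : ∀ i j → toℕ j ≡ suc (toℕ i) → edgeWeight i ≈ φ i j * φ j i
  edgeWeight-suc i j j≡1+i with ≡.refl ← next-suc j≡1+i =
    *-congˡ (sym (proj₂ skew i (next i) (inj₁ ≡.refl)))

  edgeWeight-last : edgeWeight last ≈ c₂ * c₁
  edgeWeight-last rewrite next-fromℕ L =
    *-congˡ (sym (proj₂ skew last zero (inj₁ (≡.sym (next-fromℕ L)))))

module CycleDeterminant {c ℓ} (R : CommutativeRing c ℓ) (isField : IsField R)
                        (f : CommutativeRing.Carrier R → CommutativeRing.Carrier R) (anti : IsAntiInvolution R f) where
  open CommutativeRing R hiding (zero)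
  open FiniteSums R
  open Determinant R using (Matrix; signF-double)
  open PathMatrix R
  open MatchingSums R
  open import Relation.Binary.Reasoning.Setoid setoid
  open import Algebra.Properties.Ring ring using (-‿distribˡ-*; -1*x≈-x; -‿+-comm)
  open import Algebra.Properties.CommutativeSemigroup +-commutativeSemigroup using (interchange)
  open import Algebra.Solver.CommutativeMonoid *-commutativeMonoid
    using (solve; _⊜_) renaming (_⊕_ to _⊗_)

  det-cycle-odd : ∀ k (φ : Matrix (suc (double (suc k)))) → IsSkewGain R f CycleAdj φ →
                  det R (adjMatrix R cycleAdj? φ) ≈ cycleGain R φ + f (cycleGain R φ)
  det-cycle-odd k φ skew = begin
    det R (adjMatrix R cycleAdj? φ)
      ≈⟨ det-cycleMatrix ⟩
    (det R P + signF R L * (c₂ * pathGain)) + (signF R L * (c₁ * reversePathGain) + corners)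
      ≈⟨ +-cong (+-cong (det-pathMatrix-odd (suc k) φ) (*-congʳ (signF-double (suc k))))
                (+-cong (*-congʳ (signF-double (suc k))) corners≈0) ⟩
    (0# + 1# * (c₂ * pathGain)) + (1# * (c₁ * reversePathGain) + 0#)
      ≈⟨ +-cong (trans (+-identityˡ _) (trans (*-identityˡ _) (*-comm c₂ pathGain)))
                (trans (+-identityʳ _) (trans (*-identityˡ _) (*-comm c₁ reversePathGain))) ⟩
    pathGain * c₂ + reversePathGain * c₁
      ≈⟨ +-cong cycleGain-split f-cycleGain-split ⟨
    cycleGain R φ + f (cycleGain R φ) ∎
    where
    open CycleMatrix R φ
    open SkewGainCycle R isField f anti φ skew
    corners = signF R L * (c₁ * (signF R (suc (double k)) * (c₂ * det R (pathMatrix inner))))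
    corners≈0 : corners ≈ 0#
    corners≈0 = trans (*-congˡ (*-congˡ (*-congˡ (trans (*-congˡ (det-pathMatrix-odd k inner)) (zeroʳ c₂)))))
                      (trans (*-congˡ (trans (*-congˡ (zeroʳ _)) (zeroʳ c₁))) (zeroʳ _))

  det-cycle-even : ∀ k (φ : Matrix (double (suc (suc k)))) → IsSkewGain R f CycleAdj φ →
                   det R (adjMatrix R cycleAdj? φ) ≈
                   signF R (suc (suc k)) * matchingSum R (double (suc (suc k))) f φ (suc (suc k))
                   - (cycleGain R φ + f (cycleGain R φ))
  det-cycle-even k φ skew = begin
    det R (adjMatrix R cycleAdj? φ)
      ≈⟨ det-cycleMatrix ⟩
    (det R P + signF R L * (c₂ * pathGain)) + (signF R L * (c₁ * reversePathGain) + corners)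
      ≈⟨ +-cong (+-cong (det-pathMatrix-even (suc (suc k)) φ edgeWeight edgeWeight-suc)
                        (minus-gain c₂ pathGain cycleGain-split))
                (+-cong (minus-gain c₁ reversePathGain f-cycleGain-split) corners≈) ⟩
    (s * Π-even + - γ) + (- f γ + s * Π-odd)
      ≈⟨ trans (+-congˡ (+-comm _ _)) (interchange _ _ _ _) ⟩
    (s * Π-even + s * Π-odd) + (- γ + - f γ)
      ≈⟨ +-cong (trans (sym (distribˡ s _ _)) (*-congˡ (sym matchingSum≈))) (-‿+-comm γ (f γ)) ⟩
    s * matchingSum R (double (suc (suc k))) f φ (suc (suc k)) - (γ + f γ) ∎
    where
    open CycleMatrix R φ
    open SkewGainCycle R isField f anti φ skew
    s = signF R (suc (suc k))
    s′ = signF R (suc k)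
    γ = cycleGain R φ
    corners = signF R L * (c₁ * (signF R (double (suc k)) * (c₂ * det R (pathMatrix inner))))
    Π-even = productOver (alternating inside (double (suc (suc k)))) edgeWeight
    Π-odd = productOver (alternating outside (double (suc (suc k)))) edgeWeight
    Π-inner = productOver (alternating inside (double (suc k))) (λ r → edgeWeight (suc (inject₁ r)))
    signL≈-1 : signF R L ≈ - 1#
    signL≈-1 = -‿cong (signF-double (suc k))
    minus-gain : ∀ a Π {g} → g ≈ Π * a → signF R L * (a * Π) ≈ - g
    minus-gain a Π g≈ = trans (*-congʳ signL≈-1) (trans (-1*x≈-x _) (-‿cong (trans (*-comm a Π) (sym g≈))))
    inner-weight : ∀ r s → toℕ s ≡ suc (toℕ r) → edgeWeight (suc (inject₁ r)) ≈ inner r s * inner s r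
    inner-weight r s s≡1+r = edgeWeight-suc _ _
      (≡.cong suc (≡.trans (toℕ-inject₁ s) (≡.trans s≡1+r (≡.cong suc (≡.sym (toℕ-inject₁ r))))))
    corners≈ : corners ≈ s * Π-odd
    corners≈ = begin
      corners
        ≈⟨ *-cong signL≈-1 (*-congˡ (*-cong (signF-double (suc k))
                                            (*-congˡ (det-pathMatrix-even (suc k) inner _ inner-weight)))) ⟩
      - 1# * (c₁ * (1# * (c₂ * (s′ * Π-inner))))
        ≈⟨ trans (-1*x≈-x _) (-‿cong (*-congˡ (*-identityˡ _))) ⟩
      - (c₁ * (c₂ * (s′ * Π-inner)))
        ≈⟨ -‿cong (solve 4 (λ a b σ p → a ⊗ (b ⊗ (σ ⊗ p)) ⊜ σ ⊗ (p ⊗ (b ⊗ a)))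
                           refl c₁ c₂ s′ Π-inner) ⟩
      - (s′ * (Π-inner * (c₂ * c₁)))
        ≈⟨ -‿distribˡ-* s′ _ ⟩
      s * (Π-inner * (c₂ * c₁))
        ≈⟨ *-congˡ (trans (productOver-alternating-outside k edgeWeight) (*-congˡ edgeWeight-last)) ⟨
      s * Π-odd ∎
    matchingSum≈ : matchingSum R (double (suc (suc k))) f φ (suc (suc k)) ≈ Π-even + Π-odd
    matchingSum≈ = sumL-matchings-cycle (suc k) (λ S → productOver S edgeWeight)

odd-cycle-length : ∀ (t k : ℕ) → 3 ℕ.+ t ≡ ℕ.suc (double k) → ∃ λ k′ → t ≡ double k′
odd-cycle-length t zero     ()
odd-cycle-length t (suc k′) n≡ = k′ , ℕ.suc-injective (ℕ.suc-injective (ℕ.suc-injective n≡))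

even-cycle-length : ∀ (t k : ℕ) → 3 ℕ.+ t ≡ double k →
                    ∃ λ k′ → t ≡ suc (double k′) × k ≡ suc (suc k′)
even-cycle-length t (suc (suc k′)) n≡ =
  k′ , ℕ.suc-injective (ℕ.suc-injective (ℕ.suc-injective n≡)) , ≡.refl

open import Data.Nat using (_*_; _≤_; s≤s; z≤n)
open CommutativeRing using (Carrier)
open CommutativeRing using () renaming (_≈_ to eq; _+_ to add; _*_ to mul; _-_ to sub)

corollary2p5 : ∀ {c ℓ} (F : CommutativeRing c ℓ) → IsField F → CharZero F →
    (f : Carrier F → Carrier F) → IsAntiInvolution F f →
    (n : ℕ) → 3 ≤ n →
    (φ : Fin n → Fin n → Carrier F) → IsSkewGain F f CycleAdj φ →
    ((k : ℕ) → n ≡ suc (2 * k) →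
      eq F (det F (adjMatrix F cycleAdj? φ))
           (add F (cycleGain F φ) (f (cycleGain F φ)))) ×
    ((k : ℕ) → n ≡ 2 * k →
      eq F (det F (adjMatrix F cycleAdj? φ))
           (sub F (mul F (signF F k) (matchingSum F n f φ k))
                  (add F (cycleGain F φ) (f (cycleGain F φ)))))
corollary2p5 F isField _ f anti (suc (suc (suc t))) (s≤s (s≤s (s≤s z≤n))) φ skew = odd , even
  where
  open CycleDeterminant F isField f anti
  odd : ∀ k → suc (suc (suc t)) ≡ suc (2 * k) →
        eq F (det F (adjMatrix F cycleAdj? φ)) (add F (cycleGain F φ) (f (cycleGain F φ)))
  odd k n≡1+2k with odd-cycle-length t k (≡.trans n≡1+2k (≡.cong suc (≡.sym (double≡2* k))))
  ... | k′ , ≡.refl = det-cycle-odd k′ φ skew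
  even : ∀ k → suc (suc (suc t)) ≡ 2 * k →
         eq F (det F (adjMatrix F cycleAdj? φ))
              (sub F (mul F (signF F k) (matchingSum F (suc (suc (suc t))) f φ k))
                     (add F (cycleGain F φ) (f (cycleGain F φ))))
  even k n≡2k with even-cycle-length t k (≡.trans n≡2k (≡.sym (double≡2* k)))
  ... | k′ , ≡.refl , ≡.refl = det-cycle-even k′ φ skew
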